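{- Let $d\ge3$ be an odd integer, $n\ge d$ an integer and $1\le\lambda\le d$ an integer. Writing $\overline{\lambda}=\lambda\bmod 2\in\{0,1\}$, we have \[ \sum_{i=\frac{\lambda-\overline{\lambda}}{2}}^{\frac{d-1}{2}}\binom{d}{2i+\overline{\lambda}}\binom{2i+\overline{\lambda}}{\,i-\frac{\lambda-\overline{\lambda}}{2}\,}n^{d-2i-\overline{\lambda}}\ <\ \sum_{i=0}^{\frac{d-1}{2}}\binom{d}{2i}\binom{2i}{i}n^{d-2i}. \]
   Context: Binomial coefficients with negative lower index or lower index exceeding the upper index are zero. -}

module Defs where

open import Data.Nat using (ℕ; zero; suc; _+_; _*_; _∸_; _^_)
open import Data.Nat.Combinatorics using (_C_)
open import Data.Nat.DivMod using (_/_; _%_)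

sumFromTo : ℕ → ℕ → (ℕ → ℕ) → ℕ
sumFromTo a b f = go (suc b ∸ a)
  where
  go : ℕ → ℕ
  go zero = 0
  go (suc k) = f (a + k) + go k

-- left-hand side: λbar = λ % 2, lower limit (λ - λbar)/2 = λ / 2
lhs : (d n l : ℕ) → ℕ
lhs d n l = sumFromTo (l / 2) ((d ∸ 1) / 2)
  (λ i → (d C (2 * i + l % 2)) * ((2 * i + l % 2) C (i ∸ l / 2)) * n ^ (d ∸ (2 * i + l % 2)))

rhs : (d n : ℕ) → ℕ
rhs d n = sumFromTo 0 ((d ∸ 1) / 2)
  (λ i → (d C (2 * i)) * ((2 * i) C i) * n ^ (d ∸ 2 * i))

-- Compare the two sums term by term over i ≤ (d-1)/2. For even λ the i-th left term differs
-- from the i-th right term only in C(2i, i-a) ≤ C(2i, i) (unimodality). For odd λ, unimodality,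
-- the middle absorption (i+1) C(2i+1, i) = (2i+1) C(2i, i) and (2i+1) C(d, 2i+1) ≤ d C(d, 2i)
-- show that i+1 times the left term is at most d C(d, 2i) C(2i, i) n^(d-2i-1), which is at most
-- the right term because d ≤ n. Strictness: for λ ≥ 2 the left sum omits the positive term i = 0;
-- for λ = 1 the factor i+1 ≥ 2 at the top index i = (d-1)/2 ≥ 1 makes that term strictly smaller.
module Submission where

open import Data.Nat
open import Data.Nat.Combinatorics using (_C_; nCk+nC[k+1]≡[n+1]C[k+1]; nC1≡n)
open import Data.Nat.DivMod using (_/_; _%_; m≡m%n+[m/n]*n; m%n<n; m*n/n≡m; m≥n⇒m/n>0)
open import Data.Nat.Properties
open import Algebra.Properties.CommutativeSemigroup +-commutativeSemigroup using (x∙yz≈y∙xz)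
open import Data.Nat.Tactic.RingSolver using (solve-∀)
open import Data.Sum using (inj₁; inj₂)
open import Defs
open import Relation.Binary.PropositionalEquality
open import Relation.Nullary using (yes; no)

2*n≡n+n : ∀ n → 2 * n ≡ n + n
2*n≡n+n n = cong (n +_) (+-identityʳ n)

m*n>0 : ∀ {m n} → 0 < m → 0 < n → 0 < m * n
m*n>0 {suc m} {suc n} _ _ = z<s

[1+i]*m≤n⇒m<n : ∀ {i m n} → 0 < i → 0 < n → suc i * m ≤ n → m < n
[1+i]*m≤n⇒m<n {m = zero} _ n>0 _ = n>0
[1+i]*m≤n⇒m<n {i} {suc m} i>0 _ le = <-≤-trans (m<m+n (suc m) (*-mono-≤ i>0 (s≤s z≤n))) le

nCk>0 : ∀ {n k} → k ≤ n → 0 < n C k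
nCk>0 {n} {zero} _ = z<s
nCk>0 {suc n} {suc k} (s≤s k≤n) =
  subst (0 <_) (nCk+nC[k+1]≡[n+1]C[k+1] n k) (≤-trans (nCk>0 k≤n) (m≤m+n _ _))

[k+1]*[n+1]C[k+1]≡[n+1]*nCk : ∀ n k → suc k * (suc n C suc k) ≡ suc n * (n C k)
[k+1]*[n+1]C[k+1]≡[n+1]*nCk zero zero = refl
[k+1]*[n+1]C[k+1]≡[n+1]*nCk zero (suc k) = *-zeroʳ (suc (suc k))
[k+1]*[n+1]C[k+1]≡[n+1]*nCk (suc n) zero =
  trans (*-identityˡ _) (trans (nC1≡n (suc (suc n))) (sym (*-identityʳ _)))
[k+1]*[n+1]C[k+1]≡[n+1]*nCk (suc n) (suc k) = begin
  suc (suc k) * (suc (suc n) C suc (suc k))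
    ≡⟨ cong (suc (suc k) *_) (sym (nCk+nC[k+1]≡[n+1]C[k+1] (suc n) (suc k))) ⟩
  suc (suc k) * (x + y)
    ≡⟨ regroup (suc k) x y ⟩
  x + (suc k * x + suc (suc k) * y)
    ≡⟨ cong (x +_) (cong₂ _+_ ([k+1]*[n+1]C[k+1]≡[n+1]*nCk n k)
                              ([k+1]*[n+1]C[k+1]≡[n+1]*nCk n (suc k))) ⟩
  x + (suc n * (n C k) + suc n * (n C suc k))
    ≡⟨ cong (x +_) (sym (*-distribˡ-+ (suc n) (n C k) (n C suc k))) ⟩
  x + suc n * (n C k + n C suc k)
    ≡⟨ cong (λ z → x + suc n * z) (nCk+nC[k+1]≡[n+1]C[k+1] n k) ⟩
  suc (suc n) * x ∎
  where
  open ≡-Reasoning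
  x = suc n C suc k
  y = suc n C suc (suc k)
  regroup : ∀ j x y → suc j * (x + y) ≡ x + (j * x + suc j * y)
  regroup = solve-∀

[k+1]*nC[k+1]+k*nCk≡n*nCk : ∀ n k → suc k * (n C suc k) + k * (n C k) ≡ n * (n C k)
[k+1]*nC[k+1]+k*nCk≡n*nCk zero zero = refl
[k+1]*nC[k+1]+k*nCk≡n*nCk zero (suc k) = cong₂ _+_ (*-zeroʳ (suc (suc k))) (*-zeroʳ (suc k))
[k+1]*nC[k+1]+k*nCk≡n*nCk (suc n) zero = trans (+-identityʳ _) ([k+1]*[n+1]C[k+1]≡[n+1]*nCk n 0)
[k+1]*nC[k+1]+k*nCk≡n*nCk (suc n) (suc k) = begin
  suc (suc k) * (suc n C suc (suc k)) + suc k * (suc n C suc k)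
    ≡⟨ cong₂ _+_ ([k+1]*[n+1]C[k+1]≡[n+1]*nCk n (suc k))
                 ([k+1]*[n+1]C[k+1]≡[n+1]*nCk n k) ⟩
  suc n * (n C suc k) + suc n * (n C k)
    ≡⟨ sym (*-distribˡ-+ (suc n) (n C suc k) (n C k)) ⟩
  suc n * (n C suc k + n C k)
    ≡⟨ cong (suc n *_) (trans (+-comm (n C suc k) (n C k)) (nCk+nC[k+1]≡[n+1]C[k+1] n k)) ⟩
  suc n * (suc n C suc k) ∎
  where open ≡-Reasoning

[k+1]*nC[k+1]≤n*nCk : ∀ n k → suc k * (n C suc k) ≤ n * (n C k)
[k+1]*nC[k+1]≤n*nCk n k =
  subst (suc k * (n C suc k) ≤_) ([k+1]*nC[k+1]+k*nCk≡n*nCk n k) (m≤m+n _ _)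

nCk≤nC[k+1] : ∀ {n k} → suc (k + k) ≤ n → n C k ≤ n C suc k
nCk≤nC[k+1] {n} {k} 2k<n = *-cancelˡ-≤ (suc k) (+-cancelʳ-≤ (k * (n C k)) _ _ (begin
  suc k * (n C k) + k * (n C k)     ≡⟨ sym (*-distribʳ-+ (n C k) (suc k) k) ⟩
  suc (k + k) * (n C k)             ≤⟨ *-monoˡ-≤ (n C k) 2k<n ⟩
  n * (n C k)                       ≡⟨ sym ([k+1]*nC[k+1]+k*nCk≡n*nCk n k) ⟩
  suc k * (n C suc k) + k * (n C k) ∎))
  where open ≤-Reasoning

nCj≤nCk : ∀ {n j k} → j ≤ k → k + k ≤ n → n C j ≤ n C k
nCj≤nCk {k = zero} z≤n _ = ≤-refl
nCj≤nCk {n} {j} {suc k} j≤1+k 2k+2≤n with m≤n⇒m<n∨m≡n j≤1+k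
... | inj₂ refl = ≤-refl
... | inj₁ (s≤s j≤k) = ≤-trans (nCj≤nCk j≤k (≤-trans (+-mono-≤ (n≤1+n k) (n≤1+n k)) 2k+2≤n))
                               (nCk≤nC[k+1] (≤-trans (s≤s (+-monoʳ-≤ k (n≤1+n k))) 2k+2≤n))

[2k+1]Ck≡[2k+1]C[k+1] : ∀ k → suc (2 * k) C k ≡ suc (2 * k) C suc k
[2k+1]Ck≡[2k+1]C[k+1] k = sym (*-cancelˡ-≡ _ _ (suc k) (+-cancelʳ-≡ (k * (n C k)) _ _ (begin
  suc k * (n C suc k) + k * (n C k) ≡⟨ [k+1]*nC[k+1]+k*nCk≡n*nCk n k ⟩
  n * (n C k)                       ≡⟨ cong (λ m → suc m * (n C k)) (2*n≡n+n k) ⟩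
  suc (k + k) * (n C k)             ≡⟨ *-distribʳ-+ (n C k) (suc k) k ⟩
  suc k * (n C k) + k * (n C k)     ∎)))
  where
  open ≡-Reasoning
  n = suc (2 * k)

[k+1]*[2k+1]Ck≡[2k+1]*[2k]Ck : ∀ k → suc k * (suc (2 * k) C k) ≡ suc (2 * k) * (2 * k C k)
[k+1]*[2k+1]Ck≡[2k+1]*[2k]Ck k =
  trans (cong (suc k *_) ([2k+1]Ck≡[2k+1]C[k+1] k)) ([k+1]*[n+1]C[k+1]≡[n+1]*nCk (2 * k) k)

sumFromTo-empty : ∀ {a b} (f : ℕ → ℕ) → b < a → sumFromTo a b f ≡ 0
sumFromTo-empty f b<a rewrite m≤n⇒m∸n≡0 b<a = refl

sumFromTo-snoc : ∀ {a b} (f : ℕ → ℕ) → a ≤ suc b →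
  sumFromTo a (suc b) f ≡ f (suc b) + sumFromTo a b f
sumFromTo-snoc {zero} f _ = refl
sumFromTo-snoc {suc a} {b} f (s≤s a≤b) rewrite +-∸-assoc 1 a≤b =
  cong (λ i → f i + sumFromTo (suc a) b f) (m+[n∸m]≡n (s≤s a≤b))

sumFromTo-head : ∀ b (f : ℕ → ℕ) → sumFromTo 0 b f ≡ f 0 + sumFromTo 1 b f
sumFromTo-head zero f = refl
sumFromTo-head (suc b) f =
  trans (cong (f (suc b) +_) (sumFromTo-head b f)) (x∙yz≈y∙xz (f (suc b)) (f 0) _)

sumFromTo-mono-≤ : ∀ {a a′} b {f g : ℕ → ℕ} → a′ ≤ a → (∀ i → a ≤ i → i ≤ b → f i ≤ g i) →
  sumFromTo a b f ≤ sumFromTo a′ b g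
sumFromTo-mono-≤ {a} b {f} a′≤a f≤g with a ≤? b
... | no a≰b rewrite sumFromTo-empty f (≰⇒> a≰b) = z≤n
sumFromTo-mono-≤ zero z≤n f≤g | yes z≤n = +-monoˡ-≤ 0 (f≤g 0 z≤n z≤n)
sumFromTo-mono-≤ (suc b) {f} {g} a′≤a f≤g | yes a≤b
  rewrite sumFromTo-snoc f a≤b | sumFromTo-snoc g (≤-trans a′≤a a≤b) =
  +-mono-≤ (f≤g (suc b) a≤b ≤-refl) (sumFromTo-mono-≤ b a′≤a λ i a≤i i≤b → f≤g i a≤i (m≤n⇒m≤1+n i≤b))

sumFromTo-mono-< : ∀ {a} b {f g : ℕ → ℕ} → a ≤ suc b → (∀ i → a ≤ i → i ≤ suc b → f i ≤ g i) →
  f (suc b) < g (suc b) → sumFromTo a (suc b) f < sumFromTo a (suc b) g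
sumFromTo-mono-< b {f} {g} a≤b f≤g f<g rewrite sumFromTo-snoc f a≤b | sumFromTo-snoc g a≤b =
  +-mono-<-≤ f<g (sumFromTo-mono-≤ b ≤-refl λ i a≤i i≤b → f≤g i a≤i (m≤n⇒m≤1+n i≤b))

rhsTerm : ℕ → ℕ → ℕ → ℕ
rhsTerm d n i = (d C (2 * i)) * ((2 * i) C i) * n ^ (d ∸ 2 * i)

lhsTerm : ℕ → ℕ → ℕ → ℕ → ℕ → ℕ
lhsTerm d n ε a i = (d C (2 * i + ε)) * ((2 * i + ε) C (i ∸ a)) * n ^ (d ∸ (2 * i + ε))

rhsTerm>0 : ∀ d n i → 2 * i ≤ d → 0 < n → 0 < rhsTerm d n i
rhsTerm>0 d n i 2i≤d n>0 =
  m*n>0 (m*n>0 (nCk>0 2i≤d) (nCk>0 (m≤m+n i _))) (m^n>0 n {{>-nonZero n>0}} (d ∸ 2 * i))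

lhsTerm-even≤rhsTerm : ∀ d n a i → lhsTerm d n 0 a i ≤ rhsTerm d n i
lhsTerm-even≤rhsTerm d n a i rewrite +-identityʳ (2 * i) =
  *-monoˡ-≤ (n ^ (d ∸ 2 * i))
    (*-monoʳ-≤ (d C (2 * i)) (nCj≤nCk (m∸n≤m i a) (≤-reflexive (sym (2*n≡n+n i)))))

[1+i]*lhsTerm-odd≤rhsTerm : ∀ {d n} a i → suc (2 * i) ≤ d → d ≤ n →
  suc i * lhsTerm d n 1 a i ≤ rhsTerm d n i
[1+i]*lhsTerm-odd≤rhsTerm {d} {n} a i 2i<d d≤n rewrite +-comm (2 * i) 1 = begin
  suc i * ((d C suc t) * (suc t C (i ∸ a)) * n ^ e)
    ≤⟨ *-monoʳ-≤ (suc i) (*-monoˡ-≤ (n ^ e)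
         (*-monoʳ-≤ (d C suc t) (nCj≤nCk (m∸n≤m i a) i+i≤1+t))) ⟩
  suc i * ((d C suc t) * (suc t C i) * n ^ e)
    ≡⟨ regroup₁ (suc i) (d C suc t) (suc t C i) (n ^ e) ⟩
  suc i * (suc t C i) * (d C suc t) * n ^ e
    ≡⟨ cong (λ x → x * (d C suc t) * n ^ e) ([k+1]*[2k+1]Ck≡[2k+1]*[2k]Ck i) ⟩
  suc t * (t C i) * (d C suc t) * n ^ e
    ≡⟨ regroup₂ (suc t) (t C i) (d C suc t) (n ^ e) ⟩
  suc t * (d C suc t) * (t C i) * n ^ e
    ≤⟨ *-monoˡ-≤ (n ^ e) (*-monoˡ-≤ (t C i)
         (≤-trans ([k+1]*nC[k+1]≤n*nCk d t) (*-monoˡ-≤ (d C t) d≤n))) ⟩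
  n * (d C t) * (t C i) * n ^ e
    ≡⟨ regroup₃ n (d C t) (t C i) (n ^ e) ⟩
  (d C t) * (t C i) * n ^ suc e
    ≡⟨ cong (λ x → (d C t) * (t C i) * n ^ x) (sym (+-∸-assoc 1 2i<d)) ⟩
  (d C t) * (t C i) * n ^ (d ∸ t) ∎
  where
  open ≤-Reasoning
  t = 2 * i
  e = d ∸ suc t
  i+i≤1+t : i + i ≤ suc t
  i+i≤1+t = ≤-trans (≤-reflexive (sym (2*n≡n+n i))) (n≤1+n t)
  regroup₁ : ∀ p q r s → p * (q * r * s) ≡ p * r * q * s
  regroup₁ = solve-∀
  regroup₂ : ∀ p q r s → p * q * r * s ≡ p * r * q * s
  regroup₂ = solve-∀
  regroup₃ : ∀ p q r s → p * q * r * s ≡ q * r * (p * s)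
  regroup₃ = solve-∀

lhsTerm≤rhsTerm : ∀ {d n ε} a i → ε ≤ 1 → suc (2 * i) ≤ d → d ≤ n →
  lhsTerm d n ε a i ≤ rhsTerm d n i
lhsTerm≤rhsTerm {d} {n} a i z≤n _ _ = lhsTerm-even≤rhsTerm d n a i
lhsTerm≤rhsTerm a i (s≤s z≤n) 2i<d d≤n =
  ≤-trans (m≤n*m _ (suc i)) ([1+i]*lhsTerm-odd≤rhsTerm a i 2i<d d≤n)

sumFromTo-lhsTerm<sumFromTo-rhsTerm : ∀ {d m n ε a} → d ≡ suc (2 * m) → 3 ≤ d → d ≤ n →
  ε ≤ 1 → 0 < ε + a →
  sumFromTo a m (lhsTerm d n ε a) < sumFromTo 0 m (rhsTerm d n)
sumFromTo-lhsTerm<sumFromTo-rhsTerm {m = m} {n} {ε} {suc a} refl _ d≤n ε≤1 _ = begin-strict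
  sumFromTo (suc a) m (lhsTerm d n ε (suc a)) ≤⟨ sumFromTo-mono-≤ m (s≤s z≤n) bound ⟩
  sumFromTo 1 m (rhsTerm d n)                 <⟨ m<n+m _ (rhsTerm>0 d n 0 z≤n (≤-trans z<s d≤n)) ⟩
  rhsTerm d n 0 + sumFromTo 1 m (rhsTerm d n) ≡⟨ sym (sumFromTo-head m (rhsTerm d n)) ⟩
  sumFromTo 0 m (rhsTerm d n)                 ∎
  where
  open ≤-Reasoning
  d = suc (2 * m)
  bound : ∀ i → suc a ≤ i → i ≤ m → lhsTerm d n ε (suc a) i ≤ rhsTerm d n i
  bound i _ i≤m = lhsTerm≤rhsTerm (suc a) i ε≤1 (s≤s (*-monoʳ-≤ 2 i≤m)) d≤n
sumFromTo-lhsTerm<sumFromTo-rhsTerm {m = zero} {ε = 1} {zero} refl (s≤s ()) _ _ _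
sumFromTo-lhsTerm<sumFromTo-rhsTerm {m = suc m} {n} {ε = 1} {zero} refl _ d≤n ε≤1 _ =
  sumFromTo-mono-< m z≤n bound top<
  where
  d = suc (2 * suc m)
  bound : ∀ i → 0 ≤ i → i ≤ suc m → lhsTerm d n 1 0 i ≤ rhsTerm d n i
  bound i _ i≤m = lhsTerm≤rhsTerm 0 i ε≤1 (s≤s (*-monoʳ-≤ 2 i≤m)) d≤n
  top< : lhsTerm d n 1 0 (suc m) < rhsTerm d n (suc m)
  top< = [1+i]*m≤n⇒m<n {suc m} z<s (rhsTerm>0 d n (suc m) (n≤1+n _) (≤-trans z<s d≤n))
           ([1+i]*lhsTerm-odd≤rhsTerm 0 (suc m) ≤-refl d≤n)
sumFromTo-lhsTerm<sumFromTo-rhsTerm {ε = zero} {zero} _ _ _ _ ()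
sumFromTo-lhsTerm<sumFromTo-rhsTerm {ε = suc (suc _)} {zero} _ _ _ (s≤s ()) _

n%2≡1⇒n≡1+2*[n∸1]/2 : ∀ n → n % 2 ≡ 1 → n ≡ suc (2 * ((n ∸ 1) / 2))
n%2≡1⇒n≡1+2*[n∸1]/2 n odd =
  trans n≡1+[n/2]*2 (cong suc (trans (*-comm (n / 2) 2) (cong (2 *_) (sym [n∸1]/2≡n/2))))
  where
  n≡1+[n/2]*2 : n ≡ suc (n / 2 * 2)
  n≡1+[n/2]*2 = trans (m≡m%n+[m/n]*n n 2) (cong (_+ n / 2 * 2) odd)
  [n∸1]/2≡n/2 : (n ∸ 1) / 2 ≡ n / 2
  [n∸1]/2≡n/2 = trans (cong (λ x → (x ∸ 1) / 2) n≡1+[n/2]*2) (m*n/n≡m (n / 2) 2)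

n>0⇒n%2+n/2>0 : ∀ {n} → 0 < n → 0 < n % 2 + n / 2
n>0⇒n%2+n/2>0 {1} _ = z<s
n>0⇒n%2+n/2>0 {suc (suc n)} _ =
  ≤-trans (m≥n⇒m/n>0 {suc (suc n)} {2} (s≤s (s≤s z≤n))) (m≤n+m _ (suc (suc n) % 2))

lemma2p5 : (d n l : ℕ) → 3 ≤ d → d % 2 ≡ 1 → d ≤ n → 1 ≤ l → l ≤ d →
    lhs d n l < rhs d n
lemma2p5 d n l 3≤d d-odd d≤n 1≤l _ =
  sumFromTo-lhsTerm<sumFromTo-rhsTerm (n%2≡1⇒n≡1+2*[n∸1]/2 d d-odd) 3≤d d≤n
    (≤-pred (m%n<n l 2)) (n>0⇒n%2+n/2>0 1≤l)
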